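{- Let $k\geq 1$ and let $R=R^{(k)}$ be the graph with vertices $v_1,v_2,\dots,v_{2k}$ whose edges are the pairs $(v_i,v_{i+j})$ for $i=1,\dots,2k-1$ and $j=1,2,\dots,\min\{k,2k-i\}$. Define $l(v_i)=0$ for $i\le k$ and $l(v_i)=2(i-k)$ for $i>k$. Then there exists a labelling $w:E(R)\to\{0,1,2\}$ such that: (i) for every $1\le i\le 2k$, $\sum_{e\ni v_i}w(e)+l(v_i)=2i$; (ii) the subgraph of $R$ formed by the edges labelled $1$ or $2$ contains all vertices of $R$ and has a subgraph $F$ which is either a Hamiltonian cycle of $R$ or a single edge labelled $2$. -}

module Defs where

open import Data.Nat using (ℕ; zero; suc; _+_; _*_; _∸_; _≤_; _<_; _≤?_; _<?_)
open import Data.Fin using (Fin; toℕ)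
open import Data.List using (map; allFin)
open import Data.Nat.ListAction using (sum)
open import Data.Product using (_×_; Σ; ∃; ∃-syntax)
open import Data.Sum using (_⊎_)
open import Relation.Nullary using (Dec; yes; no)
open import Relation.Nullary.Decidable using (_×-dec_)
open import Relation.Binary.PropositionalEquality using (_≡_)
open import Function.Definitions using (Injective)

-- Vertices of R^(k): Fin (2 * k); vertex a : Fin (2 * k) stands for v_{toℕ a + 1}.
Vertex : ℕ → Set
Vertex k = Fin (2 * k)

-- Oriented edge relation: (v_i , v_{i+j}) with 1 ≤ j ≤ min{k, 2k-i}
-- i.e. a < b and b ≤ a + k (the bound b ≤ 2k is automatic for vertices).
Edge : (k : ℕ) → Vertex k → Vertex k → Set
Edge k a b = (toℕ a < toℕ b) × (toℕ b ≤ toℕ a + k)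

edge? : (k : ℕ) → (a b : Vertex k) → Dec (Edge k a b)
edge? k a b = (toℕ a <? toℕ b) ×-dec (toℕ b ≤? toℕ a + k)

-- A labelling of E(R) with values in {0,1,2}: the label of the edge {v_a, v_b}
-- (a < b) is  w a b ; values of w at non-edges are irrelevant.
Labelling : ℕ → Set
Labelling k = Vertex k → Vertex k → Fin 3

wt : (k : ℕ) → Labelling k → Vertex k → Vertex k → ℕ
wt k w a b with edge? k a b | edge? k b a
... | yes _ | _     = toℕ (w a b)
... | no _  | yes _ = toℕ (w b a)
... | no _  | no _  = 0

degW : (k : ℕ) → Labelling k → Vertex k → ℕ
degW k w a = sum (map (wt k w a) (allFin (2 * k)))

l : (k : ℕ) → Vertex k → ℕ
l k a with suc (toℕ a) ≤? k
... | yes _ = 0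
... | no _  = 2 * (suc (toℕ a) ∸ k)

Spanning : (k : ℕ) → Labelling k → Set
Spanning k w = (a : Vertex k) → ∃[ b ] (1 ≤ wt k w a b)

-- a Hamiltonian cycle of R all of whose edges have label 1 or 2:
-- a cyclic ordering σ of all 2k ≥ 3 vertices such that cyclically consecutive
-- vertices are joined by an edge of R labelled 1 or 2.
HamCycleIn : (k : ℕ) → Labelling k → Set
HamCycleIn k w =
  (3 ≤ 2 * k) ×
  (Σ (Vertex k → Vertex k) λ σ →
     Injective _≡_ _≡_ σ ×
     ((s t : Vertex k) →
        (toℕ t ≡ suc (toℕ s) ⊎ (suc (toℕ s) ≡ 2 * k × toℕ t ≡ 0)) →
        1 ≤ wt k w (σ s) (σ t)))

EdgeLabelled2 : (k : ℕ) → Labelling k → Set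
EdgeLabelled2 k w = ∃[ a ] ∃[ b ] (Edge k a b × toℕ (w a b) ≡ 2)

module Submission where

open import Defs
open import Data.Nat using (ℕ; suc; _+_; _*_; _≤_)
open import Data.Fin using (toℕ)
open import Data.Product using (_×_; ∃-syntax)
open import Data.Sum using (_⊎_)
open import Relation.Binary.PropositionalEquality using (_≡_)

open import Data.Bool.Base using (if_then_else_)
open import Data.Nat using (zero; _∸_; _<_; z≤n; s≤s; s≤s⁻¹; z<s; _≤?_; _<?_)
open import Data.Nat.Properties
open import Data.Nat.Tactic.RingSolver using (solve; solve-∀)
open import Algebra.Properties.CommutativeSemigroup +-commutativeSemigroup using (interchange)
open import Data.Fin using (Fin; fromℕ<)
open import Data.Fin.Properties using (toℕ<n; toℕ-fromℕ<)
open import Data.List using ([]; _∷_; tabulate)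
open import Data.List.Properties using (map-tabulate)
open import Data.Nat.ListAction using (sum)
open import Data.Product using (_,_)
open import Data.Sum using (inj₂)
open import Relation.Nullary using (Dec; does; yes; no; ¬_; contradiction)
open import Relation.Nullary.Decidable using (_×-dec_)
open import Relation.Binary.PropositionalEquality
  using (refl; sym; trans; cong; cong₂; subst; subst₂; module ≡-Reasoning)

-- Number the vertices v_1, …, v_2k of R^(k) by x = 0, …, 2k - 1.  The
-- labelling gives the edge {x, y}, x < y ≤ x + k, two independent bits:
--   the far bit  if x + 2k ≤ 2y,  and  the near bit  if y ≤ 2x + 1.
-- The heart of the proof is the degree count: vertex x has weighted degree
-- 2(x + 1) if x < k and 2k if x ≥ k, which is property (i).  The sum over the
-- neighbours of x splits into those below and those above x; on each part a
-- bit is set either on a segment of consecutive neighbours or according to a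
-- halving condition c ≤ 2i resp. c ≤ 2i + 1, and the two halving counts are
-- added up by the halving lemma.  Positive degrees then give the spanning part
-- of (ii), and the edge {v_k, v_2k} carries both bits, so F can be taken to be
-- that single edge labelled 2.

sumBelow : ℕ → (ℕ → ℕ) → ℕ
sumBelow zero    f = 0
sumBelow (suc n) f = f 0 + sumBelow n (λ i → f (suc i))

sumBelow-cong : ∀ n {f g : ℕ → ℕ} → (∀ i → i < n → f i ≡ g i) → sumBelow n f ≡ sumBelow n g
sumBelow-cong zero    f≗g = refl
sumBelow-cong (suc n) f≗g =
  cong₂ _+_ (f≗g 0 z<s) (sumBelow-cong n (λ i i<n → f≗g (suc i) (s≤s i<n)))

sumBelow-+ : ∀ n (f g : ℕ → ℕ) → sumBelow n (λ i → f i + g i) ≡ sumBelow n f + sumBelow n g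
sumBelow-+ zero    f g = refl
sumBelow-+ (suc n) f g =
  trans (cong ((f 0 + g 0) +_) (sumBelow-+ n _ _)) (interchange (f 0) (g 0) _ _)

sumBelow-++ : ∀ m n f → sumBelow (m + n) f ≡ sumBelow m f + sumBelow n (λ i → f (m + i))
sumBelow-++ zero    n f = refl
sumBelow-++ (suc m) n f =
  trans (cong (f 0 +_) (sumBelow-++ m n _)) (sym (+-assoc (f 0) _ _))

sumBelow-around : ∀ m n f →
  sumBelow (m + suc n) f ≡ sumBelow m f + (f m + sumBelow n (λ i → f (m + suc i)))
sumBelow-around m n f = trans (sumBelow-++ m (suc n) f)
  (cong (λ t → sumBelow m f + (f t + sumBelow n (λ i → f (m + suc i)))) (+-identityʳ m))

sumBelow-snoc : ∀ n f → sumBelow (suc n) f ≡ sumBelow n f + f n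
sumBelow-snoc n f = trans (cong (λ m → sumBelow m f) (+-comm 1 n)) (trans (sumBelow-++ n 1 f)
  (cong (sumBelow n f +_) (trans (+-identityʳ _) (cong f (+-identityʳ n)))))

sumBelow-0 : ∀ n {f} → (∀ i → i < n → f i ≡ 0) → sumBelow n f ≡ 0
sumBelow-0 zero    f≡0 = refl
sumBelow-0 (suc n) f≡0 =
  cong₂ _+_ (f≡0 0 z<s) (sumBelow-0 n (λ i i<n → f≡0 (suc i) (s≤s i<n)))

sumBelow-1 : ∀ n {f} → (∀ i → i < n → f i ≡ 1) → sumBelow n f ≡ n
sumBelow-1 zero    f≡1 = refl
sumBelow-1 (suc n) f≡1 =
  cong₂ _+_ (f≡1 0 z<s) (sumBelow-1 n (λ i i<n → f≡1 (suc i) (s≤s i<n)))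

⟦_⟧ : {A : Set} → Dec A → ℕ
⟦ a? ⟧ = if does a? then 1 else 0

⟦⟧-yes : {A : Set} (a? : Dec A) → A → ⟦ a? ⟧ ≡ 1
⟦⟧-yes (yes _) _ = refl
⟦⟧-yes (no ¬a) a = contradiction a ¬a

⟦⟧-no : {A : Set} (a? : Dec A) → ¬ A → ⟦ a? ⟧ ≡ 0
⟦⟧-no (yes a) ¬a = contradiction a ¬a
⟦⟧-no (no _)  _  = refl

⟦⟧-iff : {A B : Set} (a? : Dec A) (b? : Dec B) → (A → B) → (B → A) → ⟦ a? ⟧ ≡ ⟦ b? ⟧
⟦⟧-iff a? (yes b) _   B→A = ⟦⟧-yes a? (B→A b)
⟦⟧-iff a? (no ¬b) A→B _   = ⟦⟧-no a? (λ a → ¬b (A→B a))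

⟦⟧-cancel : ∀ c {a b a′ b′} → a ≡ c + a′ → b ≡ c + b′ → ⟦ a ≤? b ⟧ ≡ ⟦ a′ ≤? b′ ⟧
⟦⟧-cancel c refl refl = ⟦⟧-iff (c + _ ≤? c + _) (_ ≤? _) (+-cancelˡ-≤ c _ _) (+-monoʳ-≤ c)

count-≤ : ∀ m n → sumBelow (suc m + n) (λ i → ⟦ i ≤? m ⟧) ≡ suc m
count-≤ m n = begin
  sumBelow (suc m + n) (λ i → ⟦ i ≤? m ⟧)
    ≡⟨ sumBelow-++ (suc m) n (λ i → ⟦ i ≤? m ⟧) ⟩
  sumBelow (suc m) (λ i → ⟦ i ≤? m ⟧) + sumBelow n (λ i → ⟦ suc m + i ≤? m ⟧)
    ≡⟨ cong₂ _+_ (sumBelow-1 (suc m) (λ i i≤m → ⟦⟧-yes (i ≤? m) (s≤s⁻¹ i≤m)))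
                 (sumBelow-0 n (λ i _ → ⟦⟧-no (suc m + i ≤? m) (<⇒≱ (s≤s (m≤m+n m i))))) ⟩
  suc m + 0
    ≡⟨ +-identityʳ (suc m) ⟩
  suc m ∎
  where open ≡-Reasoning

suc-∸ : ∀ m c → suc m ∸ c ≡ (m ∸ c) + ⟦ c ≤? m ⟧
suc-∸ m       zero    = +-comm 1 m
suc-∸ zero    (suc c) = 0∸n≡0 c
suc-∸ (suc m) (suc c) =
  trans (suc-∸ m c) (cong ((m ∸ c) +_) (sym (⟦⟧-cancel 1 {a′ = c} {b′ = m} refl refl)))

-- Halving: among 0, 1, …, 2n - 1, exactly 2n ∸ c numbers are at least c;
-- the even ones are counted by the first indicator, the odd ones by the second.
halving : ∀ c n → sumBelow n (λ i → ⟦ c ≤? 2 * i ⟧ + ⟦ c ≤? suc (2 * i) ⟧) ≡ 2 * n ∸ c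
halving c zero    = sym (0∸n≡0 c)
halving c (suc n) = begin
  sumBelow (suc n) h
    ≡⟨ sumBelow-snoc n h ⟩
  sumBelow n h + h n
    ≡⟨ cong (_+ h n) (halving c n) ⟩
  (2 * n ∸ c) + (⟦ c ≤? 2 * n ⟧ + ⟦ c ≤? suc (2 * n) ⟧)
    ≡⟨ sym (+-assoc (2 * n ∸ c) _ _) ⟩
  (2 * n ∸ c) + ⟦ c ≤? 2 * n ⟧ + ⟦ c ≤? suc (2 * n) ⟧
    ≡⟨ cong (_+ ⟦ c ≤? suc (2 * n) ⟧) (sym (suc-∸ (2 * n) c)) ⟩
  (suc (2 * n) ∸ c) + ⟦ c ≤? suc (2 * n) ⟧
    ≡⟨ sym (suc-∸ (suc (2 * n)) c) ⟩
  suc (suc (2 * n)) ∸ c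
    ≡⟨ cong (_∸ c) (solve (n ∷ [])) ⟩
  2 * suc n ∸ c ∎
  where
  open ≡-Reasoning
  h : ℕ → ℕ
  h i = ⟦ c ≤? 2 * i ⟧ + ⟦ c ≤? suc (2 * i) ⟧

halving-self : ∀ n →
  sumBelow n (λ i → ⟦ n ≤? 2 * i ⟧) + sumBelow n (λ i → ⟦ n ≤? suc (2 * i) ⟧) ≡ n
halving-self n = begin
  sumBelow n (λ i → ⟦ n ≤? 2 * i ⟧) + sumBelow n (λ i → ⟦ n ≤? suc (2 * i) ⟧)
    ≡⟨ sym (sumBelow-+ n _ _) ⟩
  sumBelow n (λ i → ⟦ n ≤? 2 * i ⟧ + ⟦ n ≤? suc (2 * i) ⟧)
    ≡⟨ halving n n ⟩
  2 * n ∸ n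
    ≡⟨ cong (_∸ n) (solve (n ∷ [])) ⟩
  n + n ∸ n
    ≡⟨ m+n∸m≡n n n ⟩
  n ∎
  where open ≡-Reasoning

sum-tabulate : ∀ n (h : Fin n → ℕ) (f : ℕ → ℕ) → (∀ b → h b ≡ f (toℕ b)) →
               sum (tabulate h) ≡ sumBelow n f
sum-tabulate zero    h f h≗f = refl
sum-tabulate (suc n) h f h≗f =
  cong₂ _+_ (h≗f Fin.zero)
            (sum-tabulate n (λ b → h (Fin.suc b)) (λ i → f (suc i)) (λ b → h≗f (Fin.suc b)))

positive-term : ∀ n (h : Fin n → ℕ) → 1 ≤ sum (tabulate h) → ∃[ b ] (1 ≤ h b)
positive-term (suc n) h pos with h Fin.zero in eq
... | suc _ = Fin.zero , subst (1 ≤_) (sym eq) (s≤s z≤n)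
... | zero  with positive-term n (λ b → h (Fin.suc b)) pos
...   | b , hb = Fin.suc b , hb

bits : {A B : Set} → Dec A → Dec B → Fin 3
bits (yes _) (yes _) = Fin.suc (Fin.suc Fin.zero)
bits (yes _) (no _)  = Fin.suc Fin.zero
bits (no _)  (yes _) = Fin.suc Fin.zero
bits (no _)  (no _)  = Fin.zero

toℕ-bits : {A B : Set} (a? : Dec A) (b? : Dec B) → toℕ (bits a? b?) ≡ ⟦ a? ⟧ + ⟦ b? ⟧
toℕ-bits (yes _) (yes _) = refl
toℕ-bits (yes _) (no _)  = refl
toℕ-bits (no _)  (yes _) = refl
toℕ-bits (no _)  (no _)  = refl

labelFin : ℕ → ℕ → ℕ → Fin 3
labelFin k x y = bits (x + 2 * k ≤? 2 * y) (y ≤? suc (2 * x))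

label : ℕ → ℕ → ℕ → ℕ
label k x y = ⟦ x + 2 * k ≤? 2 * y ⟧ + ⟦ y ≤? suc (2 * x) ⟧

labelling : (k : ℕ) → Labelling k
labelling k a b = labelFin k (toℕ a) (toℕ b)

Adjacent : ℕ → ℕ → ℕ → Set
Adjacent k x y = (x < y) × (y ≤ x + k)

adjacent? : (k x y : ℕ) → Dec (Adjacent k x y)
adjacent? k x y = (x <? y) ×-dec (y ≤? x + k)

weight : ℕ → ℕ → ℕ → ℕ
weight k x y with adjacent? k x y | adjacent? k y x
... | yes _ | _     = toℕ (labelFin k x y)
... | no _  | yes _ = toℕ (labelFin k y x)
... | no _  | no _  = 0

wt≡weight : ∀ k a b → wt k (labelling k) a b ≡ weight k (toℕ a) (toℕ b)
wt≡weight k a b with edge? k a b | edge? k b a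
... | yes _ | _     = refl
... | no _  | yes _ = refl
... | no _  | no _  = refl

weight-above : ∀ {k x y} → x < y → y ≤ x + k → weight k x y ≡ label k x y
weight-above {k} {x} {y} x<y y≤x+k with adjacent? k x y | adjacent? k y x
... | yes _   | _     = toℕ-bits (x + 2 * k ≤? 2 * y) (y ≤? suc (2 * x))
... | no ¬adj | _     = contradiction (x<y , y≤x+k) ¬adj

weight-below : ∀ {k x y} → y < x → x ≤ y + k → weight k x y ≡ label k y x
weight-below {k} {x} {y} y<x x≤y+k with adjacent? k x y | adjacent? k y x
... | yes (x<y , _) | _     = contradiction x<y (<⇒≯ y<x)
... | no _          | yes _ = toℕ-bits (y + 2 * k ≤? 2 * x) (x ≤? suc (2 * y))
... | no _          | no ¬adj = contradiction (y<x , x≤y+k) ¬adj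

weight-nonadjacent : ∀ {k x y} → ¬ Adjacent k x y → ¬ Adjacent k y x → weight k x y ≡ 0
weight-nonadjacent {k} {x} {y} ¬xy ¬yx with adjacent? k x y | adjacent? k y x
... | yes xy | _      = contradiction xy ¬xy
... | no _   | yes yx = contradiction yx ¬yx
... | no _   | no _   = refl

weight-self : ∀ k x → weight k x x ≡ 0
weight-self k x = weight-nonadjacent {k} {x} {x} irreflexive irreflexive
  where
  irreflexive : ¬ Adjacent k x x
  irreflexive (x<x , _) = <-irrefl refl x<x

near-bit : ∀ x i → ⟦ x + suc i ≤? suc (2 * x) ⟧ ≡ ⟦ i ≤? x ⟧
near-bit x i = ⟦⟧-cancel (suc x) (+-suc x i) (solve (x ∷ []))

-- Degree of a vertex x < k, written k = x + 1 + r.  Its neighbours are all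
-- y < x and x + 1, …, x + k.  Each y < x contributes only its near bit, set
-- when x ≤ 2y + 1; among the x + 1 + i (i < k) the near bit is set for i ≤ x
-- and the far bit for i = r + i′ with x ≤ 2i′.  The halving lemma adds up
-- the two halving counts to x.
module LowVertex (x r : ℕ) where
  k : ℕ
  k = suc (x + r)

  x≤k : x ≤ k
  x≤k = ≤-trans (m≤m+n x r) (n≤1+n _)

  neighbours : sumBelow (2 * k) (weight k x) ≡
               sumBelow x (λ y → label k y x) + sumBelow k (λ i → label k x (x + suc i))
  neighbours = begin
    sumBelow (2 * k) (weight k x)
      ≡⟨ cong (λ n → sumBelow n (weight k x)) (size x r) ⟩
    sumBelow (x + suc (k + r)) (weight k x)
      ≡⟨ sumBelow-around x (k + r) (weight k x) ⟩
    sumBelow x (weight k x) + (weight k x x + sumBelow (k + r) (λ i → weight k x (x + suc i)))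
      ≡⟨ cong₂ (λ s t → sumBelow x (weight k x) + (s + t))
               (weight-self k x) (sumBelow-++ k r (λ i → weight k x (x + suc i))) ⟩
    sumBelow x (weight k x) + (sumBelow k (λ i → weight k x (x + suc i)) + far-above)
      ≡⟨ cong₂ (λ s t → s + (t + far-above)) below above ⟩
    labels-below + (labels-above + far-above)
      ≡⟨ cong (λ t → labels-below + (labels-above + t)) beyond ⟩
    labels-below + (labels-above + 0)
      ≡⟨ cong (labels-below +_) (+-identityʳ _) ⟩
    labels-below + labels-above ∎
    where
    open ≡-Reasoning
    labels-below labels-above far-above : ℕ
    labels-below = sumBelow x (λ y → label k y x)
    labels-above = sumBelow k (λ i → label k x (x + suc i))
    far-above = sumBelow r (λ i → weight k x (x + suc (k + i)))
    size : ∀ x r → 2 * suc (x + r) ≡ x + suc (suc (x + r) + r)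
    size = solve-∀
    below : sumBelow x (weight k x) ≡ sumBelow x (λ y → label k y x)
    below = sumBelow-cong x (λ y y<x → weight-below y<x (≤-trans x≤k (m≤n+m k y)))
    above : sumBelow k (λ i → weight k x (x + suc i)) ≡ sumBelow k (λ i → label k x (x + suc i))
    above = sumBelow-cong k (λ i i<k → weight-above (m<m+n x z<s) (+-monoʳ-≤ x i<k))
    beyond : far-above ≡ 0
    beyond = sumBelow-0 r (λ i _ → weight-nonadjacent
      (λ (_ , far≤) → <⇒≱ (+-monoʳ-< x (s≤s (m≤m+n k i))) far≤)
      (λ (far< , _) → ≤⇒≯ (m≤m+n x _) far<))

  -- Below x only the near bit can be set, since 2x < 2k.
  below-labels : sumBelow x (λ y → label k y x) ≡ sumBelow x (λ y → ⟦ x ≤? suc (2 * y) ⟧)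
  below-labels = sumBelow-cong x (λ y _ →
    cong (_+ ⟦ x ≤? suc (2 * y) ⟧) (⟦⟧-no (y + 2 * k ≤? 2 * x) (<⇒≱ (2x<y+2k y))))
    where
    2x<y+2k : ∀ y → 2 * x < y + 2 * k
    2x<y+2k y = <-≤-trans (*-monoʳ-< 2 (s≤s (m≤m+n x r))) (m≤n+m (2 * k) y)

  -- Above x the near bit is set for the first x + 1 neighbours, and the far
  -- bit only among the last x + 1 neighbours x + 1 + (r + i), when x ≤ 2i.
  above-labels : sumBelow k (λ i → label k x (x + suc i)) ≡
                 sumBelow (suc x) (λ i → ⟦ x ≤? 2 * i ⟧) + suc x
  above-labels = begin
    sumBelow k (λ i → label k x (x + suc i))
      ≡⟨ sumBelow-+ k (λ i → ⟦ x + 2 * k ≤? 2 * (x + suc i) ⟧) (λ i → ⟦ x + suc i ≤? suc (2 * x) ⟧) ⟩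
    sumBelow k (λ i → ⟦ x + 2 * k ≤? 2 * (x + suc i) ⟧) + sumBelow k (λ i → ⟦ x + suc i ≤? suc (2 * x) ⟧)
      ≡⟨ cong₂ _+_ far-bits near-bits ⟩
    sumBelow (suc x) (λ i → ⟦ x ≤? 2 * i ⟧) + suc x ∎
    where
    open ≡-Reasoning
    far-bit : ℕ → ℕ
    far-bit i = ⟦ x + 2 * k ≤? 2 * (x + suc i) ⟧
    unset : ∀ i → i < r → far-bit i ≡ 0
    unset i i<r = ⟦⟧-no (x + 2 * k ≤? 2 * (x + suc i))
      (<⇒≱ (<-≤-trans (*-monoʳ-< 2 x+1+i<k) (m≤n+m (2 * k) x)))
      where
      x+1+i<k : x + suc i < k
      x+1+i<k = subst (_< k) (sym (+-suc x i)) (s≤s (+-monoʳ-< x i<r))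
    double : ∀ x r i → 2 * (x + suc (r + i)) ≡ 2 * suc (x + r) + 2 * i
    double = solve-∀
    far-bits : sumBelow k far-bit ≡ sumBelow (suc x) (λ i → ⟦ x ≤? 2 * i ⟧)
    far-bits = begin
      sumBelow k far-bit
        ≡⟨ cong (λ n → sumBelow n far-bit) (+-comm (suc x) r) ⟩
      sumBelow (r + suc x) far-bit
        ≡⟨ sumBelow-++ r (suc x) far-bit ⟩
      sumBelow r far-bit + sumBelow (suc x) (λ i → far-bit (r + i))
        ≡⟨ cong₂ _+_ (sumBelow-0 r unset)
                     (sumBelow-cong (suc x) (λ i _ → ⟦⟧-cancel (2 * k) (+-comm x (2 * k)) (double x r i))) ⟩
      sumBelow (suc x) (λ i → ⟦ x ≤? 2 * i ⟧) ∎
    near-bits : sumBelow k (λ i → ⟦ x + suc i ≤? suc (2 * x) ⟧) ≡ suc x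
    near-bits = trans (sumBelow-cong k (λ i _ → near-bit x i)) (count-≤ x r)

  -- Adding up: the two halving counts contribute x, the rest x + 2.
  degree : sumBelow (2 * k) (weight k x) ≡ 2 * suc x
  degree = begin
    sumBelow (2 * k) (weight k x)
      ≡⟨ trans neighbours (cong₂ _+_ below-labels above-labels) ⟩
    odds + (sumBelow (suc x) (λ i → ⟦ x ≤? 2 * i ⟧) + suc x)
      ≡⟨ cong (λ e → odds + (e + suc x)) (sumBelow-snoc x (λ i → ⟦ x ≤? 2 * i ⟧)) ⟩
    odds + ((evens + ⟦ x ≤? 2 * x ⟧) + suc x)
      ≡⟨ cong (λ b → odds + ((evens + b) + suc x)) (⟦⟧-yes (x ≤? 2 * x) (m≤m+n x _)) ⟩
    odds + ((evens + 1) + suc x)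
      ≡⟨ regroup odds evens x ⟩
    (evens + odds) + suc (suc x)
      ≡⟨ cong (_+ suc (suc x)) (halving-self x) ⟩
    x + suc (suc x)
      ≡⟨ solve (x ∷ []) ⟩
    2 * suc x ∎
    where
    open ≡-Reasoning
    odds evens : ℕ
    odds = sumBelow x (λ y → ⟦ x ≤? suc (2 * y) ⟧)
    evens = sumBelow x (λ i → ⟦ x ≤? 2 * i ⟧)
    regroup : ∀ o e x → o + ((e + 1) + suc x) ≡ (e + o) + suc (suc x)
    regroup = solve-∀

-- Degree of a vertex x = k + j ≥ k, written k = j + 1 + r.  Its neighbours are
-- j + i (i < k) below and x + 1 + i (i < r) above.  Below x the far bit is set
-- on the first j + 1 neighbours and the near bit by a halving condition; above x
-- the near bit is always set and the far bit by a halving condition.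
module HighVertex (j r : ℕ) where
  k x : ℕ
  k = suc (j + r)
  x = k + j

  neighbours : sumBelow (2 * k) (weight k x) ≡
               sumBelow k (λ i → label k (j + i) x) + sumBelow r (λ i → label k x (x + suc i))
  neighbours = begin
    sumBelow (2 * k) (weight k x)
      ≡⟨ cong (λ n → sumBelow n (weight k x)) (size j r) ⟩
    sumBelow (x + suc r) (weight k x)
      ≡⟨ sumBelow-around x r (weight k x) ⟩
    sumBelow x (weight k x) + (weight k x x + sumBelow r (λ i → weight k x (x + suc i)))
      ≡⟨ cong₂ (λ s t → s + (t + weights-above)) split-below (weight-self k x) ⟩
    (sumBelow j (weight k x) + sumBelow k (λ i → weight k x (j + i))) + weights-above
      ≡⟨ cong₂ _+_ (cong₂ _+_ beyond below) above ⟩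
    sumBelow k (λ i → label k (j + i) x) + sumBelow r (λ i → label k x (x + suc i)) ∎
    where
    open ≡-Reasoning
    weights-above : ℕ
    weights-above = sumBelow r (λ i → weight k x (x + suc i))
    size : ∀ j r → 2 * suc (j + r) ≡ (suc (j + r) + j) + suc r
    size = solve-∀
    split-below : sumBelow x (weight k x) ≡ sumBelow j (weight k x) + sumBelow k (λ i → weight k x (j + i))
    split-below = trans (cong (λ n → sumBelow n (weight k x)) (+-comm k j)) (sumBelow-++ j k (weight k x))
    beyond : sumBelow j (weight k x) ≡ 0
    beyond = sumBelow-0 j (λ y y<j → weight-nonadjacent
      (λ (x<y , _) → <⇒≯ (<-≤-trans y<j (m≤n+m j k)) x<y)
      (λ (_ , x≤y+k) → <⇒≱ (subst (y + k <_) (+-comm j k) (+-monoˡ-< k y<j)) x≤y+k))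
    below : sumBelow k (λ i → weight k x (j + i)) ≡ sumBelow k (λ i → label k (j + i) x)
    below = sumBelow-cong k (λ i i<k → weight-below
      (subst (j + i <_) (+-comm j k) (+-monoʳ-< j i<k))
      (subst (_≤ j + i + k) (+-comm j k) (+-monoˡ-≤ k (m≤m+n j i))))
    above : weights-above ≡ sumBelow r (λ i → label k x (x + suc i))
    above = sumBelow-cong r (λ i i<r → weight-above (m<m+n x z<s)
      (+-monoʳ-≤ x (≤-trans i<r (≤-trans (m≤n+m r j) (n≤1+n _)))))

  -- Below x the far bit is set for j + i with i ≤ j, the near bit when r ≤ 2i.
  below-labels : sumBelow k (λ i → label k (j + i) x) ≡
                 suc j + (sumBelow r (λ i → ⟦ r ≤? 2 * i ⟧) + suc j)
  below-labels = begin
    sumBelow k (λ i → label k (j + i) x)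
      ≡⟨ sumBelow-+ k (λ i → ⟦ j + i + 2 * k ≤? 2 * x ⟧) (λ i → ⟦ x ≤? suc (2 * (j + i)) ⟧) ⟩
    sumBelow k (λ i → ⟦ j + i + 2 * k ≤? 2 * x ⟧) + sumBelow k (λ i → ⟦ x ≤? suc (2 * (j + i)) ⟧)
      ≡⟨ cong₂ _+_
           (sumBelow-cong k (λ i _ → ⟦⟧-cancel (j + 2 * k) (swap j i (2 * k)) (double k j)))
           (sumBelow-cong k (λ i _ → ⟦⟧-cancel (suc (2 * j)) (x-split j r) (twice j i))) ⟩
    sumBelow k (λ i → ⟦ i ≤? j ⟧) + sumBelow k (λ i → ⟦ r ≤? 2 * i ⟧)
      ≡⟨ cong₂ _+_ (count-≤ j r) near-bits ⟩
    suc j + (sumBelow r (λ i → ⟦ r ≤? 2 * i ⟧) + suc j) ∎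
    where
    open ≡-Reasoning
    swap : ∀ a b c → a + b + c ≡ (a + c) + b
    swap = solve-∀
    double : ∀ k j → 2 * (k + j) ≡ (j + 2 * k) + j
    double = solve-∀
    x-split : ∀ j r → suc (j + r) + j ≡ suc (2 * j) + r
    x-split = solve-∀
    twice : ∀ j i → suc (2 * (j + i)) ≡ suc (2 * j) + 2 * i
    twice = solve-∀
    near-bits : sumBelow k (λ i → ⟦ r ≤? 2 * i ⟧) ≡ sumBelow r (λ i → ⟦ r ≤? 2 * i ⟧) + suc j
    near-bits = begin
      sumBelow k (λ i → ⟦ r ≤? 2 * i ⟧)
        ≡⟨ cong (λ n → sumBelow n (λ i → ⟦ r ≤? 2 * i ⟧)) (+-comm (suc j) r) ⟩
      sumBelow (r + suc j) (λ i → ⟦ r ≤? 2 * i ⟧)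
        ≡⟨ sumBelow-++ r (suc j) (λ i → ⟦ r ≤? 2 * i ⟧) ⟩
      sumBelow r (λ i → ⟦ r ≤? 2 * i ⟧) + sumBelow (suc j) (λ i → ⟦ r ≤? 2 * (r + i) ⟧)
        ≡⟨ cong (sumBelow r (λ i → ⟦ r ≤? 2 * i ⟧) +_)
             (sumBelow-1 (suc j) (λ i _ → ⟦⟧-yes (r ≤? 2 * (r + i)) (≤-trans (m≤m+n r i) (m≤m+n (r + i) _)))) ⟩
      sumBelow r (λ i → ⟦ r ≤? 2 * i ⟧) + suc j ∎

  -- Above x the near bit is always set, the far bit exactly when r ≤ 2i + 1.
  above-labels : sumBelow r (λ i → label k x (x + suc i)) ≡
                 sumBelow r (λ i → ⟦ r ≤? suc (2 * i) ⟧) + r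
  above-labels = begin
    sumBelow r (λ i → label k x (x + suc i))
      ≡⟨ sumBelow-+ r (λ i → ⟦ x + 2 * k ≤? 2 * (x + suc i) ⟧) (λ i → ⟦ x + suc i ≤? suc (2 * x) ⟧) ⟩
    sumBelow r (λ i → ⟦ x + 2 * k ≤? 2 * (x + suc i) ⟧) + sumBelow r (λ i → ⟦ x + suc i ≤? suc (2 * x) ⟧)
      ≡⟨ cong₂ _+_
           (sumBelow-cong r (λ i _ → ⟦⟧-cancel (3 + 4 * j + 2 * r) (lhs j r) (rhs j r i)))
           (sumBelow-1 r (λ i i<r → trans (near-bit x i) (⟦⟧-yes (i ≤? x) (i≤x i i<r)))) ⟩
    sumBelow r (λ i → ⟦ r ≤? suc (2 * i) ⟧) + r ∎
    where
    open ≡-Reasoning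
    lhs : ∀ j r → suc (j + r) + j + 2 * suc (j + r) ≡ (3 + 4 * j + 2 * r) + r
    lhs = solve-∀
    rhs : ∀ j r i → 2 * (suc (j + r) + j + suc i) ≡ (3 + 4 * j + 2 * r) + suc (2 * i)
    rhs = solve-∀
    i≤x : ∀ i → i < r → i ≤ x
    i≤x i i<r = ≤-trans (<⇒≤ i<r) (≤-trans (m≤n+m r j) (≤-trans (n≤1+n _) (m≤m+n k j)))

  -- Adding up: the two halving counts contribute r, the rest 2j + 2 + r.
  degree : sumBelow (2 * k) (weight k x) ≡ 2 * k
  degree = begin
    sumBelow (2 * k) (weight k x)
      ≡⟨ trans neighbours (cong₂ _+_ below-labels above-labels) ⟩
    (suc j + (evens + suc j)) + (odds + r)
      ≡⟨ regroup j evens odds r ⟩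
    (evens + odds) + (suc j + suc j + r)
      ≡⟨ cong (_+ (suc j + suc j + r)) (halving-self r) ⟩
    r + (suc j + suc j + r)
      ≡⟨ solve (j ∷ r ∷ []) ⟩
    2 * suc (j + r) ∎
    where
    open ≡-Reasoning
    evens odds : ℕ
    evens = sumBelow r (λ i → ⟦ r ≤? 2 * i ⟧)
    odds = sumBelow r (λ i → ⟦ r ≤? suc (2 * i) ⟧)
    regroup : ∀ j e o r → (suc j + (e + suc j)) + (o + r) ≡ (e + o) + (suc j + suc j + r)
    regroup = solve-∀

degree-low : ∀ {k x} → x < k → sumBelow (2 * k) (weight k x) ≡ 2 * suc x
degree-low {x = x} x<k with m≤n⇒∃[o]m+o≡n x<k
... | r , refl = LowVertex.degree x r

excess<k : ∀ k j → k + j < 2 * k → j < k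
excess<k k j k+j<2k = +-cancelˡ-< k j k (subst (k + j <_) (cong (k +_) (+-identityʳ k)) k+j<2k)

degree-high : ∀ {k x} → k ≤ x → x < 2 * k → sumBelow (2 * k) (weight k x) ≡ 2 * k
degree-high {k} k≤x x<2k with m≤n⇒∃[o]m+o≡n k≤x
... | j , refl with m≤n⇒∃[o]m+o≡n (excess<k k j x<2k)
...   | r , refl = HighVertex.degree j r

degW-tabulate : ∀ k w a → degW k w a ≡ sum (tabulate (wt k w a))
degW-tabulate k w a = cong sum (map-tabulate (λ b → b) (wt k w a))

degW≡ : ∀ k a → degW k (labelling k) a ≡ sumBelow (2 * k) (weight k (toℕ a))
degW≡ k a = trans (degW-tabulate k (labelling k) a) (sum-tabulate (2 * k) _ _ (wt≡weight k a))

balanced : ∀ k a → degW k (labelling k) a + l k a ≡ 2 * suc (toℕ a)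
balanced k a with suc (toℕ a) ≤? k
... | yes x<k = trans (cong (_+ 0) (trans (degW≡ k a) (degree-low x<k))) (+-identityʳ _)
... | no x≮k  = begin
  degW k (labelling k) a + 2 * (suc (toℕ a) ∸ k)
    ≡⟨ cong (_+ 2 * (suc (toℕ a) ∸ k)) (trans (degW≡ k a) (degree-high k≤x (toℕ<n a))) ⟩
  2 * k + 2 * (suc (toℕ a) ∸ k)
    ≡⟨ sym (*-distribˡ-+ 2 k _) ⟩
  2 * (k + (suc (toℕ a) ∸ k))
    ≡⟨ cong (2 *_) (m+[n∸m]≡n (≤-trans k≤x (n≤1+n _))) ⟩
  2 * suc (toℕ a) ∎
  where
  open ≡-Reasoning
  k≤x : k ≤ toℕ a
  k≤x = s≤s⁻¹ (≰⇒> x≮k)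

-- Property (ii), first half: every vertex has positive weighted degree, hence
-- lies on an edge labelled 1 or 2.
spanning : ∀ k → 1 ≤ k → Spanning k (labelling k)
spanning k 1≤k a = positive-term (2 * k) (wt k (labelling k) a)
  (subst (1 ≤_) (degW-tabulate k (labelling k) a) (positive-degree (suc (toℕ a) ≤? k)))
  where
  positive-degree : Dec (toℕ a < k) → 1 ≤ degW k (labelling k) a
  positive-degree (yes x<k) = subst (1 ≤_) (sym (trans (degW≡ k a) (degree-low x<k))) (s≤s z≤n)
  positive-degree (no x≮k)  =
    subst (1 ≤_) (sym (trans (degW≡ k a) (degree-high (s≤s⁻¹ (≰⇒> x≮k)) (toℕ<n a))))
          (≤-trans 1≤k (m≤m+n k _))

-- Property (ii), second half: the edge {v_k, v_2k} carries both bits, i.e. label 2.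
top-edge : ∀ k → 1 ≤ k → EdgeLabelled2 k (labelling k)
top-edge (suc m) _ = a , b , edge , labelled-2
  where
  2k≡ : ∀ m → 2 * suc m ≡ suc (suc (2 * m))
  2k≡ = solve-∀
  2k-1≡ : ∀ m → suc (2 * m) ≡ m + suc m
  2k-1≡ = solve-∀
  m<2k : m < 2 * suc m
  m<2k = <-≤-trans (n<1+n m) (m≤m+n (suc m) _)
  2m+1<2k : suc (2 * m) < 2 * suc m
  2m+1<2k = ≤-reflexive (sym (2k≡ m))
  a b : Vertex (suc m)
  a = fromℕ< m<2k
  b = fromℕ< 2m+1<2k
  ta : toℕ a ≡ m
  ta = toℕ-fromℕ< m<2k
  tb : toℕ b ≡ suc (2 * m)
  tb = toℕ-fromℕ< 2m+1<2k
  edge : Edge (suc m) a b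
  edge = subst₂ _<_ (sym ta) (sym tb) (s≤s (m≤m+n m _)) ,
         subst₂ (λ s t → s ≤ t + suc m) (sym tb) (sym ta) (≤-reflexive (2k-1≡ m))
  labelled-2 : toℕ (labelling (suc m) a b) ≡ 2
  labelled-2 = begin
    toℕ (labelling (suc m) a b)
      ≡⟨ toℕ-bits (toℕ a + 2 * suc m ≤? 2 * toℕ b) (toℕ b ≤? suc (2 * toℕ a)) ⟩
    label (suc m) (toℕ a) (toℕ b)
      ≡⟨ cong₂ (label (suc m)) ta tb ⟩
    label (suc m) m (suc (2 * m))
      ≡⟨ cong₂ _+_ (⟦⟧-yes (m + 2 * suc m ≤? 2 * suc (2 * m))
                           (subst (m + 2 * suc m ≤_) (far-bit-set m) (m≤m+n _ m)))
                   (⟦⟧-yes (suc (2 * m) ≤? suc (2 * m)) ≤-refl) ⟩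
    2 ∎
    where
    open ≡-Reasoning
    far-bit-set : ∀ m → (m + 2 * suc m) + m ≡ 2 * suc (2 * m)
    far-bit-set = solve-∀

lemma3p1 : (k : ℕ) → 1 ≤ k →
    ∃[ w ] (((a : Vertex k) → degW k w a + l k a ≡ 2 * suc (toℕ a))
           × Spanning k w
           × (HamCycleIn k w ⊎ EdgeLabelled2 k w))
lemma3p1 k 1≤k = labelling k , balanced k , spanning k 1≤k , inj₂ (top-edge k 1≤k)
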